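{- Let $k\ge2$ and let $\gamma$ be a positive integer. Then the number of systems $\Gamma$ (as defined in the context) with $\gamma(\Gamma)=\gamma$ satisfies $$\#\{\Gamma:\ \gamma(\Gamma)=\gamma\}\le\prod_{p^e\,\|\,\gamma}S(k,k-e)\le\binom{k}{2}^{\#\{p^e:\ p \text{ prime},\ e\ge1,\ p^e\mid\gamma\}}.$$
   Context: A system $\Gamma=\{\gamma_{i,j}:\ 0\le i\ne j\le k-1\}$ consists of positive squarefree integers with $\gamma_{i,j}=\gamma_{j,i}$ and such that $\gcd(\gamma_{i,j},\gamma_{j,l})$ divides $\gamma_{i,l}$ for all distinct $i,j,l$. Put $\gamma_j=\operatorname{lcm}_{0\le i\le j-1}\gamma_{i,j}$ for $1\le j\le k-1$ and $\gamma(\Gamma)=\gamma_1\gamma_2\cdots\gamma_{k-1}$. $S(k,\ell)$ denotes the Stirling number of the second kind (number of partitions of a $k$-element set into $\ell$ nonempty blocks), with $S(k,\ell)=0$ for $\ell\le 0<k$. $p^e\|\gamma$ means $p^e\mid\gamma$ and $p^{e+1}\nmid\gamma$. -}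

module Defs where

open import Data.Nat using (ℕ; zero; suc; _+_; _*_; _∸_; _^_; _≤_; _<_; _<?_)
open import Data.Nat.Divisibility using (_∣_; _∣?_)
open import Data.Nat.GCD using (gcd)
open import Data.Nat.LCM using (lcm)
open import Data.Nat.Primality using (Prime; prime?)
open import Data.Fin using (Fin; toℕ)
open import Data.List using (List; []; _∷_; map; filter; foldr; length; upTo; concatMap; allFin)
open import Data.Nat.ListAction using (product)
open import Data.Product using (_×_; _,_; ∃₂)
open import Relation.Nullary using (¬_)
open import Relation.Nullary.Decidable using (_×-dec_; ¬?)
open import Relation.Binary.PropositionalEquality using (_≡_; _≢_)

-- Stirling numbers of the second kind; S (suc n) 0 = 0 (so S(k,ℓ)=0 for ℓ≤0<k,
-- where k - e is truncated subtraction).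
S : ℕ → ℕ → ℕ
S zero    zero    = 1
S zero    (suc _) = 0
S (suc n) zero    = 0
S (suc n) (suc l) = suc l * S n (suc l) + S n l

SquareFree : ℕ → Set
SquareFree n = ∀ p → Prime p → ¬ (p * p ∣ n)

-- A system Γ = {γ_{i,j} : i ≠ j}; diagonal entries γ i i are ignored.
record System (k : ℕ) : Set where
  field
    γ        : Fin k → Fin k → ℕ
    positive : ∀ i j → i ≢ j → 0 < γ i j
    sqfree   : ∀ i j → i ≢ j → SquareFree (γ i j)
    symm     : ∀ i j → i ≢ j → γ i j ≡ γ j i
    gcdCond  : ∀ i j l → i ≢ j → j ≢ l → i ≢ l → gcd (γ i j) (γ j l) ∣ γ i l
open System public

Different : ∀ {k} → System k → System k → Set
Different {k} Γ Δ = ∃₂ λ (i j : Fin k) → i ≢ j × γ Γ i j ≢ γ Δ i j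

lcmList : List ℕ → ℕ
lcmList = foldr lcm 1

gammaJ : ∀ {k} → System k → Fin k → ℕ
gammaJ {k} Γ j = lcmList (map (λ i → γ Γ i j) (filter (λ i → toℕ i <? toℕ j) (allFin k)))

-- γ(Γ) = γ_1 ⋯ γ_{k-1}  (the j = 0 factor is the empty lcm = 1)
gammaOf : ∀ {k} → System k → ℕ
gammaOf {k} Γ = product (map (gammaJ Γ) (allFin k))

pairsUpTo : ℕ → List (ℕ × ℕ)
pairsUpTo n = concatMap (λ p → map (λ e → (p , e)) (upTo (suc n))) (upTo (suc n))

-- prime powers p^e (e ≥ 1) dividing n, as pairs (p , e)   (for n > 0, p, e ≤ n)
primePowerDivisors : ℕ → List (ℕ × ℕ)
primePowerDivisors n =
  filter (λ { (p , e) → prime? p ×-dec (0 <? e ×-dec (p ^ e ∣? n)) }) (pairsUpTo n)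

exactPrimePowers : ℕ → List (ℕ × ℕ)
exactPrimePowers n =
  filter (λ { (p , e) → prime? p ×-dec (0 <? e ×-dec ((p ^ e ∣? n) ×-dec ¬? (p ^ suc e ∣? n))) })
         (pairsUpTo n)

stirlingProd : ℕ → ℕ → ℕ
stirlingProd k n = product (map (λ { (p , e) → S k (k ∸ e) }) (exactPrimePowers n))

numPrimePowers : ℕ → ℕ
numPrimePowers n = length (primePowerDivisors n)

-- For a prime q ∣ γ, the relation q ∣ γ_{i,j} on indices is an equivalence relation (the gcd
-- condition is transitivity). As the γ_j are squarefree, the exponent of q in γ = γ_1⋯γ_{k-1} is the
-- number of j related to some i < j, so the partition has k − e blocks when q^e ∥ γ. Squarefree
-- entries are determined by their prime divisors, so Γ is determined by these partitions, one per
-- q ∣ γ; encoding partitions by restricted growth strings gives at most ∏ S(k, k − e) systems.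
-- The second bound is S(k, k − e) ≤ C(k,2)^e, from the Stirling recurrence, together with
-- Σ_{p^e ∥ γ} e = #{p^e : p^e ∣ γ}.

module Submission where

open import Defs
open import Data.Bool using (Bool; true; false; if_then_else_; not; _∨_)
open import Data.Bool.Properties using (∨-zeroʳ; ⇔→≡)
open import Data.Fin using (Fin; zero; suc; toℕ)
open import Data.Fin.Properties using (toℕ-fromℕ<; toℕ-injective; toℕ<n)
open import Data.List
  using ( List; []; _∷_; [_]; _++_; map; filter; concatMap; length; upTo; applyUpTo; tabulate; allFin
        ; cartesianProductWith)
open import Data.List.Properties
  using ( length-++; length-map; length-upTo; length-applyUpTo; length-removeAt′; ∷-injective; map-++
        ; ++-identityʳ; upTo-∷ʳ; map-tabulate; map-∘; map-cong
        ; filter-++; filter-accept; filter-reject; filter-all; filter-none)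
open import Data.List.Membership.Propositional using (_∈_; lose)
open import Data.List.Membership.Propositional.Properties
  using ( ∈-++⁺ˡ; ∈-++⁺ʳ; ∈-map⁺; ∈-map⁻; ∈-upTo⁺; ∈-cartesianProductWith⁺; ∈-concatMap⁺
        ; ∈-filter⁺; ∈-filter⁻; ∈-allFin)
open import Data.List.Relation.Unary.All as All using (All; []; _∷_)
open import Data.List.Relation.Unary.All.Properties using (applyUpTo⁺₁)
import Data.List.Relation.Unary.All.Properties as All
open import Data.List.Relation.Unary.AllPairs using (AllPairs; []; _∷_)
open import Data.List.Relation.Unary.Any using (here; there; _─_; index)
open import Data.Nat
open import Data.Nat.LCM using (lcm; lcm-least; m∣lcm[m,n]; n∣lcm[m,n])
open import Data.Nat.Primality.Factorisation using (factorise)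
open import Data.Nat.Coprimality using (Coprime; coprime-divisor)
open import Data.Nat.Divisibility
open import Data.Nat.Primality
  using (Prime; prime?; euclidsLemma; prime⇒nonZero; prime⇒nonTrivial; prime⇒irreducible)
open import Data.Nat.DivMod using (_mod_; m%n<n; m<n⇒m%n≡m)
open import Data.Nat.GCD using (gcd-greatest)
open import Data.Nat.Combinatorics using (_C_; nC1≡n; nCk+nC[k+1]≡[n+1]C[k+1])
open import Data.Nat.ListAction using (product)
open import Data.Nat.ListAction.Properties using (product-++; ∈⇒∣product)
open import Data.Nat.Properties
open import Data.Product using (∃; _×_; _,_; proj₁; proj₂)
open import Data.Sum using (_⊎_; inj₁; inj₂)
open import Function using (_∘_; id)
open import Function.Bundles using (mk⇔)
open import Relation.Binary.Definitions using (tri<; tri≈; tri>)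
open import Relation.Binary.PropositionalEquality hiding ([_])
open import Relation.Nullary using (¬_; Dec; yes; no; does; contradiction)
open import Relation.Nullary.Decidable using (_×-dec_; ¬?; dec-true)
open import Relation.Unary using (Pred; Decidable)
open import Level using (0ℓ)

S-vanishes : ∀ {n m} → n < m → S n m ≡ 0
S-vanishes {zero}  {suc m} _         = refl
S-vanishes {suc n} {suc m} (s≤s n<m)
  rewrite S-vanishes (m<n⇒m<1+n n<m) | S-vanishes n<m | *-zeroʳ m = refl

S-diagonal : ∀ n → S n n ≡ 1
S-diagonal zero = refl
S-diagonal (suc n) rewrite S-vanishes (n<1+n n) | S-diagonal n | *-zeroʳ n = refl

[1+n]C2≡n+nC2 : ∀ n → suc n C 2 ≡ n + n C 2
[1+n]C2≡n+nC2 n = trans (sym (nCk+nC[k+1]≡[n+1]C[k+1] n 1)) (cong (_+ n C 2) (nC1≡n n))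

S[n,n∸e]≤[nC2]^e : ∀ n e → .{{NonZero n}} → S n (n ∸ e) ≤ (n C 2) ^ e
S[n,n∸e]≤[nC2]^e n zero rewrite S-diagonal n = ≤-refl
S[n,n∸e]≤[nC2]^e (suc n) (suc e) with n ∸ e in n∸e≡
... | zero = z≤n
S[n,n∸e]≤[nC2]^e (suc zero) (suc e) | suc l with () ← trans (sym (0∸n≡0 e)) n∸e≡
S[n,n∸e]≤[nC2]^e (suc n@(suc _)) (suc e) | suc l = begin
    suc l * S n (suc l) + S n l
  ≤⟨ +-mono-≤ (*-mono-≤ 1+l≤n (subst (λ z → S n z ≤ c ^ e) n∸e≡ (S[n,n∸e]≤[nC2]^e n e)))
              (subst (λ z → S n z ≤ c * c ^ e) n∸[1+e]≡l (S[n,n∸e]≤[nC2]^e n (suc e))) ⟩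
    n * c ^ e + c * c ^ e
  ≡⟨ *-distribʳ-+ (c ^ e) n c ⟨
    (n + c) * c ^ e
  ≤⟨ *-monoʳ-≤ (n + c) (^-monoˡ-≤ e (m≤n+m c n)) ⟩
    (n + c) * (n + c) ^ e
  ≡⟨ cong (λ z → z * z ^ e) ([1+n]C2≡n+nC2 n) ⟨
    (suc n C 2) * (suc n C 2) ^ e ∎
  where
  open ≤-Reasoning
  c = n C 2
  1+l≤n : suc l ≤ n
  1+l≤n = subst (_≤ n) n∸e≡ (m∸n≤m n e)
  n∸[1+e]≡l : n ∸ suc e ≡ l
  n∸[1+e]≡l = trans (sym (pred[m∸n]≡m∸[1+n] n e)) (cong pred n∸e≡)

prime≥2 : ∀ {p} → Prime p → 2 ≤ p
prime≥2 {p} p-prime = nonTrivial⇒n>1 p {{prime⇒nonTrivial p-prime}}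

p∤1 : ∀ {p} → Prime p → ¬ p ∣ 1
p∤1 p-prime p∣1 = <⇒≢ (prime≥2 p-prime) (sym (∣1⇒≡1 p∣1))

prime∤⇒coprime : ∀ {p n} → Prime p → ¬ p ∣ n → Coprime p n
prime∤⇒coprime p-prime p∤n (d∣p , d∣n) with prime⇒irreducible p-prime d∣p
... | inj₁ d≡1  = d≡1
... | inj₂ refl = contradiction d∣n p∤n

^-monoʳ-∣ : ∀ p {m n} → m ≤ n → p ^ m ∣ p ^ n
^-monoʳ-∣ p {m} {n} m≤n = divides (p ^ (n ∸ m)) (begin-equality
  p ^ n              ≡⟨ cong (p ^_) (m+[n∸m]≡n m≤n) ⟨
  p ^ (m + (n ∸ m))  ≡⟨ ^-distribˡ-+-* p m (n ∸ m) ⟩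
  p ^ m * p ^ (n ∸ m) ≡⟨ *-comm (p ^ m) _ ⟩
  p ^ (n ∸ m) * p ^ m ∎)
  where open ∣-Reasoning

n<p^n : ∀ {p} → 2 ≤ p → ∀ n → n < p ^ n
n<p^n p≥2 zero    = s≤s z≤n
n<p^n {p} p≥2 (suc n) = begin-strict
  suc n         ≤⟨ n<p^n p≥2 n ⟩
  p ^ n         <⟨ m<m+n (p ^ n) (≤-trans (s≤s z≤n) (n<p^n p≥2 n)) ⟩
  p ^ n + p ^ n ≡⟨ cong (p ^ n +_) (+-identityʳ (p ^ n)) ⟨
  2 * p ^ n     ≤⟨ *-monoˡ-≤ (p ^ n) p≥2 ⟩
  p * p ^ n     ∎
  where open ≤-Reasoning

_∥_ : ℕ × ℕ → ℕ → Set
(p , e) ∥ n = p ^ e ∣ n × ¬ p ^ suc e ∣ n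

∥-unique : ∀ {p e e′ n} → (p , e) ∥ n → (p , e′) ∥ n → e ≡ e′
∥-unique {p} {e} {e′} (pᵉ∣n , pᵉ⁺¹∤n) (pᵉ′∣n , pᵉ′⁺¹∤n) with <-cmp e e′
... | tri< e<e′ _ _ = contradiction (∣-trans (^-monoʳ-∣ p e<e′) pᵉ′∣n) pᵉ⁺¹∤n
... | tri≈ _ e≡e′ _ = e≡e′
... | tri> _ _ e′<e = contradiction (∣-trans (^-monoʳ-∣ p e′<e) pᵉ∣n) pᵉ′⁺¹∤n

prime^∣*⇒∣ʳ : ∀ {p x} → Prime p → ¬ p ∣ x → ∀ m {y} → p ^ m ∣ x * y → p ^ m ∣ y
prime^∣*⇒∣ʳ _ _ zero _ = 1∣ _
prime^∣*⇒∣ʳ {p} {x} p-prime p∤x (suc m) {y} pᵐ⁺¹∣xy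
  with euclidsLemma x y p-prime (∣-trans (m∣m*n (p ^ m)) pᵐ⁺¹∣xy)
... | inj₁ p∣x = contradiction p∣x p∤x
... | inj₂ (divides q refl) =
  subst (p * p ^ m ∣_) (*-comm p q) (*-monoʳ-∣ p (prime^∣*⇒∣ʳ p-prime p∤x m (*-cancelˡ-∣ p pᵐ⁺¹∣pxq)))
  where
  instance _ = prime⇒nonZero p-prime
  pᵐ⁺¹∣pxq : p * p ^ m ∣ p * (x * q)
  pᵐ⁺¹∣pxq = subst (p * p ^ m ∣_) (trans (sym (*-assoc x q p)) (*-comm (x * q) p)) pᵐ⁺¹∣xy

prime²∣*⇒∣ʳ : ∀ {p x y} → Prime p → ¬ p ∣ x → p * p ∣ x * y → p * p ∣ y
prime²∣*⇒∣ʳ {p} {x} {y} p-prime p∤x p²∣xy =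
  subst (_∣ y) p^2≡p*p (prime^∣*⇒∣ʳ p-prime p∤x 2 (subst (_∣ x * y) (sym p^2≡p*p) p²∣xy))
  where
  p^2≡p*p : p ^ 2 ≡ p * p
  p^2≡p*p = cong (p *_) (*-identityʳ p)

∥-product : ∀ {p} → Prime p → ∀ {xs} → All (λ x → ¬ p * p ∣ x) xs →
            (p , length (filter (p ∣?_) xs)) ∥ product xs
∥-product p-prime [] = 1∣ 1 , λ p∣1 → p∤1 p-prime (∣-trans (m∣m*n _) p∣1)
∥-product {p} p-prime {x ∷ xs} (p²∤x ∷ p²∤xs) with p ∣? x | ∥-product p-prime p²∤xs
... | no p∤x | pᶜ∣ , pᶜ⁺¹∤ =
  ∣n⇒∣m*n x pᶜ∣ , pᶜ⁺¹∤ ∘ prime^∣*⇒∣ʳ p-prime p∤x (suc (length (filter (p ∣?_) xs)))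
... | yes (divides a refl) | pᶜ∣ , pᶜ⁺¹∤ =
  *-pres-∣ (n∣m*n a) pᶜ∣ ,
  pᶜ⁺¹∤ ∘ prime^∣*⇒∣ʳ p-prime p∤a (suc c) ∘ *-cancelˡ-∣ p ∘ subst (p ^ suc (suc c) ∣_) regroup
  where
  c = length (filter (p ∣?_) xs)
  instance _ = prime⇒nonZero p-prime
  p∤a : ¬ p ∣ a
  p∤a p∣a = p²∤x (*-monoˡ-∣ p p∣a)
  regroup : a * p * product xs ≡ p * (a * product xs)
  regroup = trans (cong (_* product xs) (*-comm a p)) (*-assoc p a (product xs))

prime∣lcm⇒∣⊎∣ : ∀ {p} → Prime p → ∀ {a b} → p ∣ lcm a b → p ∣ a ⊎ p ∣ b
prime∣lcm⇒∣⊎∣ p-prime {a} {b} p∣lcm =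
  euclidsLemma a b p-prime (∣-trans p∣lcm (lcm-least {a} {b} (m∣m*n b) (n∣m*n a)))

prime∣lcmList⇒∣∈ : ∀ {p} → Prime p → ∀ xs → p ∣ lcmList xs → ∃ λ x → x ∈ xs × p ∣ x
prime∣lcmList⇒∣∈ p-prime []       p∣1 = contradiction p∣1 (p∤1 p-prime)
prime∣lcmList⇒∣∈ p-prime (x ∷ xs) p∣lcm with prime∣lcm⇒∣⊎∣ p-prime p∣lcm
... | inj₁ p∣x   = x , here refl , p∣x
... | inj₂ p∣lcm′ = let y , y∈xs , p∣y = prime∣lcmList⇒∣∈ p-prime xs p∣lcm′ in y , there y∈xs , p∣y

∈⇒∣lcmList : ∀ {x xs} → x ∈ xs → x ∣ lcmList xs
∈⇒∣lcmList {xs = x ∷ xs} (here refl)  = m∣lcm[m,n] x (lcmList xs)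
∈⇒∣lcmList {xs = y ∷ xs} (there x∈xs) = ∣-trans (∈⇒∣lcmList x∈xs) (n∣lcm[m,n] y (lcmList xs))

prime²∤lcm : ∀ {p} → Prime p → ∀ {a b} → ¬ p * p ∣ a → ¬ p * p ∣ b → ¬ p * p ∣ lcm a b
prime²∤lcm {p} p-prime {a} {b} p²∤a p²∤b p²∣lcm with p ∣? a | p ∣? b
... | no p∤a | _ = p²∤b (prime²∣*⇒∣ʳ p-prime p∤a (∣-trans p²∣lcm (lcm-least {a} {b} (m∣m*n b) (n∣m*n a))))
... | yes _ | no p∤b = p²∤a (prime²∣*⇒∣ʳ p-prime p∤b (∣-trans p²∣lcm (lcm-least {a} {b} (n∣m*n b) (m∣m*n a))))
... | yes (divides a′ refl) | yes (divides b′ refl)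
  with euclidsLemma a′ b′ p-prime (*-cancelʳ-∣ p (∣-trans p²∣lcm
         (lcm-least {a′ * p} {b′ * p} (*-monoˡ-∣ p (m∣m*n {a′} b′)) (*-monoˡ-∣ p (n∣m*n a′ {b′})))))
  where instance _ = prime⇒nonZero p-prime
... | inj₁ p∣a′ = p²∤a (*-monoˡ-∣ p p∣a′)
... | inj₂ p∣b′ = p²∤b (*-monoˡ-∣ p p∣b′)

prime²∤lcmList : ∀ {p} → Prime p → ∀ {xs} → All (λ x → ¬ p * p ∣ x) xs → ¬ p * p ∣ lcmList xs
prime²∤lcmList p-prime []               = p∤1 p-prime ∘ ∣-trans (m∣m*n _)
prime²∤lcmList p-prime (p²∤x ∷ p²∤xs) = prime²∤lcm p-prime p²∤x (prime²∤lcmList p-prime p²∤xs)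

coprime-*-∣ : ∀ {m n b} → Coprime m n → m ∣ b → n ∣ b → m * n ∣ b
coprime-*-∣ {m} {n} m⊥n m∣b (divides c refl) =
  *-monoˡ-∣ n (coprime-divisor m⊥n (subst (m ∣_) (*-comm c n) m∣b))

product-squarefree-∣ : ∀ {b} ps → All Prime ps → SquareFree (product ps) →
                       (∀ {p} → Prime p → p ∣ product ps → p ∣ b) → product ps ∣ b
product-squarefree-∣ []       _                   _  _    = 1∣ _
product-squarefree-∣ (q ∷ qs) (q-prime ∷ qs-prime) sf divb =
  coprime-*-∣ (prime∤⇒coprime q-prime q∤qs) (divb q-prime (m∣m*n _))
    (product-squarefree-∣ qs qs-prime (λ p p-prime → sf p p-prime ∘ ∣n⇒∣m*n q)
                                      (λ p-prime → divb p-prime ∘ ∣n⇒∣m*n q))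
  where
  q∤qs : ¬ q ∣ product qs
  q∤qs = sf q q-prime ∘ *-monoʳ-∣ q

squarefree-∣ : ∀ {a b} → .{{NonZero a}} → SquareFree a → (∀ {p} → Prime p → p ∣ a → p ∣ b) → a ∣ b
squarefree-∣ {a} sf divb with factorise a
... | record { factors = ps ; isFactorisation = refl ; factorsPrime = ps-prime } =
  product-squarefree-∣ ps ps-prime sf divb

squarefree-≡ : ∀ {a b} → .{{NonZero a}} → .{{NonZero b}} → SquareFree a → SquareFree b →
               (∀ {p} → Prime p → p ∣ a → p ∣ b) → (∀ {p} → Prime p → p ∣ b → p ∣ a) → a ≡ b
squarefree-≡ sf-a sf-b a⇒b b⇒a = ∣-antisym (squarefree-∣ sf-a a⇒b) (squarefree-∣ sf-b b⇒a)

IsExactPrimePower : ℕ → ℕ × ℕ → Set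
IsExactPrimePower n (p , e) = Prime p × 0 < e × (p , e) ∥ n

exactPrimePower? : ∀ n → Decidable (IsExactPrimePower n)
exactPrimePower? n (p , e) = prime? p ×-dec (0 <? e ×-dec ((p ^ e ∣? n) ×-dec ¬? (p ^ suc e ∣? n)))

IsPrimePowerDivisor : ℕ → ℕ × ℕ → Set
IsPrimePowerDivisor n (p , e) = Prime p × 0 < e × p ^ e ∣ n

primePowerDivisor? : ∀ n → Decidable (IsPrimePowerDivisor n)
primePowerDivisor? n (p , e) = prime? p ×-dec (0 <? e ×-dec (p ^ e ∣? n))

∈-pairsUpTo : ∀ {n p e} → p ≤ n → e ≤ n → (p , e) ∈ pairsUpTo n
∈-pairsUpTo {n} {p} p≤n e≤n = ∈-concatMap⁺ (λ p → map (p ,_) (upTo (suc n)))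
  (lose (∈-upTo⁺ (s≤s p≤n)) (∈-map⁺ (p ,_) (∈-upTo⁺ (s≤s e≤n))))

∥⇒∈exactPrimePowers : ∀ {p e n} → .{{NonZero n}} → Prime p → 0 < e → (p , e) ∥ n → (p , e) ∈ exactPrimePowers n
∥⇒∈exactPrimePowers {p} {e@(suc e′)} {n} p-prime e>0 pᵉ∥n@(pᵉ∣n , _) =
  ∈-filter⁺ (exactPrimePower? n) (∈-pairsUpTo (∣⇒≤ p∣n) e≤n) (p-prime , e>0 , pᵉ∥n)
  where
  p∣n : p ∣ n
  p∣n = ∣-trans (m∣m*n (p ^ e′)) pᵉ∣n
  e≤n : e ≤ n
  e≤n = ≤-trans (<⇒≤ (n<p^n (prime≥2 p-prime) e)) (∣⇒≤ pᵉ∣n)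

module _ {A : Set} {P Q : Pred A 0ℓ} (P? : Decidable P) (Q? : Decidable Q) (f : A → ℕ) (c : ℕ) where

  product-filter-concatMap-≤ : ∀ (blocks : ℕ → List A) ps →
    (∀ p → product (map f (filter P? (blocks p))) ≤ c ^ length (filter Q? (blocks p))) →
    product (map f (filter P? (concatMap blocks ps))) ≤ c ^ length (filter Q? (concatMap blocks ps))
  product-filter-concatMap-≤ blocks []       _     = ≤-refl
  product-filter-concatMap-≤ blocks (p ∷ ps) bound
    rewrite filter-++ P? (blocks p) (concatMap blocks ps) | filter-++ Q? (blocks p) (concatMap blocks ps)
          | map-++ f (filter P? (blocks p)) (filter P? (concatMap blocks ps))
          | product-++ (map f (filter P? (blocks p))) (map f (filter P? (concatMap blocks ps)))
          | length-++ (filter Q? (blocks p)) {filter Q? (concatMap blocks ps)}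
          | ^-distribˡ-+-* c (length (filter Q? (blocks p))) (length (filter Q? (concatMap blocks ps)))
    = *-mono-≤ (bound p) (product-filter-concatMap-≤ blocks ps bound)

powersOf : ℕ → ℕ → List (ℕ × ℕ)
powersOf p m = map (p ,_) (upTo m)

powersOf-suc : ∀ p m → powersOf p (suc m) ≡ powersOf p m ++ [ (p , m) ]
powersOf-suc p m = trans (cong (map (p ,_)) (sym (upTo-∷ʳ m))) (map-++ (p ,_) (upTo m) [ m ])

module _ (n : ℕ) {c : ℕ} .{{_ : NonZero c}} (g : ℕ → ℕ) (g≤c^ : ∀ e → g e ≤ c ^ e) (p : ℕ) where

  private
    E? = exactPrimePower? n
    D? = primePowerDivisor? n

  filter-exact-top : ∀ {m} → IsExactPrimePower n (p , m) → filter E? (powersOf p (suc m)) ≡ [ (p , m) ]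
  filter-exact-top {m} pᵐ-exact = begin
      filter E? (powersOf p (suc m))
    ≡⟨ trans (cong (filter E?) (powersOf-suc p m)) (filter-++ E? (powersOf p m) _) ⟩
      filter E? (powersOf p m) ++ filter E? [ (p , m) ]
    ≡⟨ cong₂ _++_ (filter-none E? (All.map⁺ (applyUpTo⁺₁ id m λ e<m (_ , _ , pᵉ-exact) →
                     <⇒≢ e<m (∥-unique pᵉ-exact (proj₂ (proj₂ pᵐ-exact))))))
                  (filter-accept E? pᵐ-exact) ⟩
      [ (p , m) ] ∎
    where open ≡-Reasoning

  length-filter-divisors-top : ∀ {m} → IsExactPrimePower n (p , m) → length (filter D? (powersOf p (suc m))) ≡ m
  length-filter-divisors-top {m} (p-prime , _ , pᵐ∣n , _) = begin
      length (filter D? ((p , 0) ∷ map (p ,_) (applyUpTo suc m)))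
    ≡⟨ cong length (filter-reject D? {x = p , 0} λ ()) ⟩
      length (filter D? (map (p ,_) (applyUpTo suc m)))
    ≡⟨ cong length (filter-all D? (All.map⁺ (applyUpTo⁺₁ suc m λ i<m →
                     p-prime , s≤s z≤n , ∣-trans (^-monoʳ-∣ p i<m) pᵐ∣n))) ⟩
      length (map (p ,_) (applyUpTo suc m))
    ≡⟨ trans (length-map (p ,_) (applyUpTo suc m)) (length-applyUpTo suc m) ⟩
      m ∎
    where open ≡-Reasoning

  filter-exact-non-top : ∀ {m} → ¬ IsExactPrimePower n (p , m) →
                         filter E? (powersOf p (suc m)) ≡ filter E? (powersOf p m)
  filter-exact-non-top {m} ¬pᵐ-exact = begin
      filter E? (powersOf p (suc m))
    ≡⟨ trans (cong (filter E?) (powersOf-suc p m)) (filter-++ E? (powersOf p m) _) ⟩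
      filter E? (powersOf p m) ++ filter E? [ (p , m) ]
    ≡⟨ trans (cong (filter E? (powersOf p m) ++_) (filter-reject E? ¬pᵐ-exact)) (++-identityʳ _) ⟩
      filter E? (powersOf p m) ∎
    where open ≡-Reasoning

  length-filter-divisors-suc : ∀ m → length (filter D? (powersOf p m)) ≤ length (filter D? (powersOf p (suc m)))
  length-filter-divisors-suc m = begin
      length (filter D? (powersOf p m))
    ≤⟨ m≤m+n _ _ ⟩
      length (filter D? (powersOf p m)) + length (filter D? [ (p , m) ])
    ≡⟨ length-++ (filter D? (powersOf p m)) ⟨
      length (filter D? (powersOf p m) ++ filter D? [ (p , m) ])
    ≡⟨ cong length (trans (cong (filter D?) (powersOf-suc p m)) (filter-++ D? (powersOf p m) _)) ⟨
      length (filter D? (powersOf p (suc m))) ∎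
    where open ≤-Reasoning

  powersOf-exact-bound : ∀ m →
    product (map (g ∘ proj₂) (filter E? (powersOf p m))) ≤ c ^ length (filter D? (powersOf p m))
  powersOf-exact-bound zero = ≤-refl
  powersOf-exact-bound (suc m) with E? (p , m)
  ... | yes pᵐ-exact = begin
      product (map (g ∘ proj₂) (filter E? (powersOf p (suc m))))
    ≡⟨ cong (product ∘ map (g ∘ proj₂)) (filter-exact-top pᵐ-exact) ⟩
      g m * 1
    ≡⟨ *-identityʳ (g m) ⟩
      g m
    ≤⟨ g≤c^ m ⟩
      c ^ m
    ≡⟨ cong (c ^_) (length-filter-divisors-top pᵐ-exact) ⟨
      c ^ length (filter D? (powersOf p (suc m))) ∎
    where open ≤-Reasoning
  ... | no ¬pᵐ-exact = begin
      product (map (g ∘ proj₂) (filter E? (powersOf p (suc m))))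
    ≡⟨ cong (product ∘ map (g ∘ proj₂)) (filter-exact-non-top ¬pᵐ-exact) ⟩
      product (map (g ∘ proj₂) (filter E? (powersOf p m)))
    ≤⟨ powersOf-exact-bound m ⟩
      c ^ length (filter D? (powersOf p m))
    ≤⟨ ^-monoʳ-≤ c (length-filter-divisors-suc m) ⟩
      c ^ length (filter D? (powersOf p (suc m))) ∎
    where open ≤-Reasoning

stirlingProd≤[kC2]^numPrimePowers : ∀ k n → 2 ≤ k → stirlingProd k n ≤ (k C 2) ^ numPrimePowers n
stirlingProd≤[kC2]^numPrimePowers k@(suc (suc j)) n (s≤s (s≤s z≤n)) =
  product-filter-concatMap-≤ (exactPrimePower? n) (primePowerDivisor? n) (λ (_ , e) → S k (k ∸ e)) (k C 2)
    (λ p → powersOf p (suc n)) (upTo (suc n))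
    (λ p → powersOf-exact-bound n (λ e → S k (k ∸ e)) (λ e → S[n,n∸e]≤[nC2]^e k e) p (suc n))
  where
  instance
    kC2≢0 : NonZero (k C 2)
    kC2≢0 = subst NonZero (sym ([1+n]C2≡n+nC2 (suc j))) _

length-cartesianProductWith : ∀ {A B C : Set} (f : A → B → C) xs ys →
  length (cartesianProductWith f xs ys) ≡ length xs * length ys
length-cartesianProductWith f []       ys = refl
length-cartesianProductWith f (x ∷ xs) ys = begin
    length (map (f x) ys ++ cartesianProductWith f xs ys)
  ≡⟨ length-++ (map (f x) ys) ⟩
    length (map (f x) ys) + length (cartesianProductWith f xs ys)
  ≡⟨ cong₂ _+_ (length-map (f x) ys) (length-cartesianProductWith f xs ys) ⟩
    length ys + length xs * length ys ∎
  where open ≡-Reasoning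

choices : {A : Set} → List (List A) → List (List A)
choices []         = [ [] ]
choices (xs ∷ xss) = cartesianProductWith _∷_ xs (choices xss)

length-choices : {A : Set} (xss : List (List A)) → length (choices xss) ≡ product (map length xss)
length-choices []         = refl
length-choices (xs ∷ xss) =
  trans (length-cartesianProductWith _∷_ xs (choices xss)) (cong (length xs *_) (length-choices xss))

map-∈-choices : {A B : Set} (f : B → A) (g : B → List A) (ys : List B) →
  (∀ {y} → y ∈ ys → f y ∈ g y) → map f ys ∈ choices (map g ys)
map-∈-choices f g []       _ = here refl
map-∈-choices f g (y ∷ ys) h =
  ∈-cartesianProductWith⁺ _∷_ (h (here refl)) (map-∈-choices f g ys (h ∘ there))

∈-─ : {A : Set} {x y : A} {ys : List A} (x∈ys : x ∈ ys) → y ∈ ys → y ≢ x → y ∈ (ys ─ x∈ys)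
∈-─ (here refl) (here refl) y≢x = contradiction refl y≢x
∈-─ (here refl) (there y∈ys) _  = y∈ys
∈-─ (there _)   (here refl)  _  = here refl
∈-─ (there x∈ys) (there y∈ys) y≢x = there (∈-─ x∈ys y∈ys y≢x)

distinct-⊆⇒length-≤ : {A : Set} {xs ys : List A} → AllPairs _≢_ xs → All (_∈ ys) xs → length xs ≤ length ys
distinct-⊆⇒length-≤ []                   []                 = z≤n
distinct-⊆⇒length-≤ {xs = _ ∷ xs} {ys} (x≢xs ∷ xs-distinct) (x∈ys ∷ xs⊆ys) = begin
    suc (length xs)
  ≤⟨ s≤s (distinct-⊆⇒length-≤ xs-distinct
            (All.zipWith (λ (x≢y , y∈ys) → ∈-─ x∈ys y∈ys (x≢y ∘ sym)) (x≢xs , xs⊆ys))) ⟩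
    suc (length (ys ─ x∈ys))
  ≡⟨ length-removeAt′ ys (index x∈ys) ⟨
    length ys ∎
  where open ≤-Reasoning

map-≡-at : {A B : Set} {f g : A → B} {xs : List A} {x : A} → map f xs ≡ map g xs → x ∈ xs → f x ≡ g x
map-≡-at {xs = _ ∷ _} eq (here refl)  = proj₁ (∷-injective eq)
map-≡-at {xs = _ ∷ _} eq (there x∈xs) = map-≡-at (proj₂ (∷-injective eq)) x∈xs

map-AllPairs-≢ : {A B : Set} {P : A → Set} {R : A → A → Set} {xs : List A} (f : A → B) →
  (∀ {x y} → P x → P y → R x y → f x ≢ f y) → All P xs → AllPairs R xs → AllPairs _≢_ (map f xs)
map-AllPairs-≢ f f-inj []         []         = []
map-AllPairs-≢ f f-inj (px ∷ pxs) (rxs ∷ rs) =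
  All.map⁺ (All.zipWith (λ (py , rxy) → f-inj px py rxy) (pxs , rxs)) ∷ map-AllPairs-≢ f f-inj pxs rs

count : (ℕ → Bool) → ℕ → ℕ
count h zero    = 0
count h (suc n) = if h n then suc (count h n) else count h n

count-suc-≤ : ∀ h n → count h n ≤ count h (suc n)
count-suc-≤ h n with h n
... | true  = n≤1+n _
... | false = ≤-refl

count-mono-≤ : ∀ h {m n} → m ≤ n → count h m ≤ count h n
count-mono-≤ h {n = zero} z≤n = ≤-refl
count-mono-≤ h {m} {suc n} m≤1+n with m≤n⇒m<n∨m≡n m≤1+n
... | inj₁ (s≤s m≤n) = ≤-trans (count-mono-≤ h m≤n) (count-suc-≤ h n)
... | inj₂ refl      = ≤-refl

count-< : ∀ h {i i′} → h i ≡ true → i < i′ → count h i < count h i′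
count-< h {i} hi i<i′ = subst (_≤ _) count-step (count-mono-≤ h i<i′)
  where
  count-step : count h (suc i) ≡ suc (count h i)
  count-step rewrite hi = refl

count-injective : ∀ h {i i′} → h i ≡ true → h i′ ≡ true → count h i ≡ count h i′ → i ≡ i′
count-injective h {i} {i′} hi hi′ eq with <-cmp i i′
... | tri< i<i′ _ _ = contradiction eq (<⇒≢ (count-< h hi i<i′))
... | tri≈ _ i≡i′ _ = i≡i′
... | tri> _ _ i′<i = contradiction (sym eq) (<⇒≢ (count-< h hi′ i′<i))

count+count-not : ∀ h n → count h n + count (not ∘ h) n ≡ n
count+count-not h zero = refl
count+count-not h (suc n) with h n
... | true  = cong suc (count+count-not h n)
... | false = trans (+-suc (count h n) _) (cong suc (count+count-not h n))

count-suc-front : ∀ h n → count h (suc n) ≡ (if h 0 then suc (count (h ∘ suc) n) else count (h ∘ suc) n)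
count-suc-front h zero = refl
count-suc-front h (suc n) rewrite count-suc-front h n with h 0 | h (suc n)
... | true  | true  = refl
... | true  | false = refl
... | false | true  = refl
... | false | false = refl

length-filter-tabulate : ∀ {A : Set} {P : Pred A 0ℓ} (P? : Decidable P) {n} (f : Fin n → A) (h : ℕ → Bool) →
  (∀ i → does (P? (f i)) ≡ h (toℕ i)) → length (filter P? (tabulate f)) ≡ count h n
length-filter-tabulate P? {zero}  f h agree = refl
length-filter-tabulate P? {suc n} f h agree
  rewrite count-suc-front h n with P? (f zero) | h 0 | agree zero
... | yes _ | true  | _  = cong suc (length-filter-tabulate P? (f ∘ suc) (h ∘ suc) (agree ∘ suc))
... | no _  | false | _  = length-filter-tabulate P? (f ∘ suc) (h ∘ suc) (agree ∘ suc)

relatedBelow : (ℕ → ℕ → Bool) → ℕ → ℕ → Bool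
relatedBelow r j zero    = false
relatedBelow r j (suc m) = relatedBelow r j m ∨ r m j

joinsEarlier : (ℕ → ℕ → Bool) → ℕ → Bool
joinsEarlier r j = relatedBelow r j j

blockCount : (ℕ → ℕ → Bool) → ℕ → ℕ
blockCount r = count (not ∘ joinsEarlier r)

joinCount : (ℕ → ℕ → Bool) → ℕ → ℕ
joinCount r = count (joinsEarlier r)

firstRelated : (ℕ → ℕ → Bool) → ℕ → ℕ → ℕ
firstRelated r j zero    = 0
firstRelated r j (suc m) = if relatedBelow r j m then firstRelated r j m else m

-- Blocks are numbered in the order of their least elements; element n is labelled 0 if it is
-- the least element of its block and 1 + (number of its block) otherwise.
blockLabel : (ℕ → ℕ → Bool) → ℕ → ℕ
blockLabel r n = if joinsEarlier r n then suc (blockCount r (firstRelated r n n)) else 0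

blockCode : (ℕ → ℕ → Bool) → ℕ → List ℕ
blockCode r zero    = []
blockCode r (suc n) = blockLabel r n ∷ blockCode r n

blockCodes : ℕ → ℕ → List (List ℕ)
blockCodes zero    zero    = [ [] ]
blockCodes zero    (suc b) = []
blockCodes (suc n) zero    = []
blockCodes (suc n) (suc b) =
  cartesianProductWith (λ x c → suc x ∷ c) (upTo (suc b)) (blockCodes n (suc b)) ++ map (0 ∷_) (blockCodes n b)

length-blockCodes : ∀ n b → length (blockCodes n b) ≡ S n b
length-blockCodes zero    zero    = refl
length-blockCodes zero    (suc b) = refl
length-blockCodes (suc n) zero    = refl
length-blockCodes (suc n) (suc b) = begin
    length (joins ++ map (0 ∷_) (blockCodes n b))
  ≡⟨ length-++ joins ⟩
    length joins + length (map (0 ∷_) (blockCodes n b))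
  ≡⟨ cong₂ _+_ (length-cartesianProductWith (λ x c → suc x ∷ c) (upTo (suc b)) (blockCodes n (suc b)))
               (length-map (0 ∷_) (blockCodes n b)) ⟩
    length (upTo (suc b)) * length (blockCodes n (suc b)) + length (blockCodes n b)
  ≡⟨ cong₂ (λ x y → x * y + length (blockCodes n b)) (length-upTo (suc b)) (length-blockCodes n (suc b)) ⟩
    suc b * S n (suc b) + length (blockCodes n b)
  ≡⟨ cong (suc b * S n (suc b) +_) (length-blockCodes n b) ⟩
    S (suc n) (suc b) ∎
  where
  open ≡-Reasoning
  joins = cartesianProductWith (λ x c → suc x ∷ c) (upTo (suc b)) (blockCodes n (suc b))

∷-∈-blockCodes-join : ∀ {n b x c} → x < b → c ∈ blockCodes n b → suc x ∷ c ∈ blockCodes (suc n) b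
∷-∈-blockCodes-join {b = suc b} x<b c∈ =
  ∈-++⁺ˡ (∈-cartesianProductWith⁺ (λ x c → suc x ∷ c) (∈-upTo⁺ x<b) c∈)

∷-∈-blockCodes-open : ∀ {n b c} → c ∈ blockCodes n b → 0 ∷ c ∈ blockCodes (suc n) (suc b)
∷-∈-blockCodes-open {n} {b} c∈ =
  ∈-++⁺ʳ (cartesianProductWith (λ x c → suc x ∷ c) (upTo (suc b)) (blockCodes n (suc b))) (∈-map⁺ (0 ∷_) c∈)

module _ (r : ℕ → ℕ → Bool) where

  relatedBelow-intro : ∀ {i j m} → i < m → r i j ≡ true → relatedBelow r j m ≡ true
  relatedBelow-intro {m = suc m} i<1+m rij with m<1+n⇒m<n∨m≡n i<1+m
  ... | inj₁ i<m  rewrite relatedBelow-intro i<m rij = refl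
  ... | inj₂ refl rewrite rij = ∨-zeroʳ _

  relatedBelow-false : ∀ {i j m} → relatedBelow r j m ≡ false → i < m → r i j ≡ false
  relatedBelow-false {i} {j} e i<m with r i j in rij
  ... | false = refl
  ... | true with () ← trans (sym (relatedBelow-intro i<m rij)) e

  relatedBelow-none : ∀ {j m} → (∀ {i} → i < m → r i j ≡ false) → relatedBelow r j m ≡ false
  relatedBelow-none {m = zero}  _ = refl
  relatedBelow-none {m = suc m} h rewrite relatedBelow-none {m = m} (h ∘ m<n⇒m<1+n) = h ≤-refl

  firstRelated-spec : ∀ {j m} → relatedBelow r j m ≡ true →
    firstRelated r j m < m × r (firstRelated r j m) j ≡ true × (∀ {i} → i < firstRelated r j m → r i j ≡ false)
  firstRelated-spec {j} {suc m} e with relatedBelow r j m in eq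
  ... | true  = let i<m , rij , least = firstRelated-spec eq in m<n⇒m<1+n i<m , rij , least
  ... | false = ≤-refl , e , relatedBelow-false eq

  blockCount+joinCount : ∀ n → blockCount r n + joinCount r n ≡ n
  blockCount+joinCount n = trans (+-comm (blockCount r n) _) (count+count-not (joinsEarlier r) n)

SymmetricBelow : ℕ → (ℕ → ℕ → Bool) → Set
SymmetricBelow K r = ∀ {i j} → i < K → j < K → i ≢ j → r i j ≡ r j i

TransitiveBelow : ℕ → (ℕ → ℕ → Bool) → Set
TransitiveBelow K r = ∀ {i j l} → i < K → j < K → l < K → i ≢ j → j ≢ l → i ≢ l →
  r i j ≡ true → r j l ≡ true → r i l ≡ true

module _ {K : ℕ} {r : ℕ → ℕ → Bool} (r-trans : TransitiveBelow K r) where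

  firstRelated-opens : ∀ {n} → n < K → joinsEarlier r n ≡ true → joinsEarlier r (firstRelated r n n) ≡ false
  firstRelated-opens {n} n<K joins = relatedBelow-none r unrelated
    where
    i₀ = firstRelated r n n
    spec = firstRelated-spec r joins
    i₀<n = proj₁ spec
    i₀<K = <-trans i₀<n n<K
    unrelated : ∀ {i} → i < i₀ → r i i₀ ≡ false
    unrelated {i} i<i₀ with r i i₀ in rii₀
    ... | false = refl
    ... | true with () ← trans (sym (proj₂ (proj₂ spec) i<i₀))
          (r-trans (<-trans i<i₀ i₀<K) i₀<K n<K (<⇒≢ i<i₀) (<⇒≢ i₀<n) (<⇒≢ (<-trans i<i₀ i₀<n))
                   rii₀ (proj₁ (proj₂ spec)))

  blockCode-∈ : ∀ {n} → n ≤ K → blockCode r n ∈ blockCodes n (blockCount r n)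
  blockCode-∈ {zero}  _    = here refl
  blockCode-∈ {suc n} n<K with joinsEarlier r n in joins
  ... | false = ∷-∈-blockCodes-open {n} (blockCode-∈ (<⇒≤ n<K))
  ... | true  = ∷-∈-blockCodes-join {n}
        (count-< (not ∘ joinsEarlier r) {i′ = n} (cong not (firstRelated-opens n<K joins))
                 (proj₁ (firstRelated-spec r {n} {n} joins)))
        (blockCode-∈ (<⇒≤ n<K))

module _ {K : ℕ} {r : ℕ → ℕ → Bool} (r-sym : SymmetricBelow K r) (r-trans : TransitiveBelow K r) where

  related-through : ∀ {i₀ i n} → i₀ < i → i < n → n < K → r i₀ n ≡ true → r i n ≡ r i₀ i
  related-through {i₀} {i} {n} i₀<i i<n n<K ri₀n = ⇔→≡ {z = true} (mk⇔ to from)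
    where
    i<K = <-trans i<n n<K
    i₀<K = <-trans i₀<i i<K
    i₀<n = <-trans i₀<i i<n
    to : r i n ≡ true → r i₀ i ≡ true
    to rin = r-trans i₀<K n<K i<K (<⇒≢ i₀<n) (>⇒≢ i<n) (<⇒≢ i₀<i) ri₀n
               (trans (r-sym n<K i<K (>⇒≢ i<n)) rin)
    from : r i₀ i ≡ true → r i n ≡ true
    from ri₀i = r-trans i<K i₀<K n<K (>⇒≢ i₀<i) (<⇒≢ i₀<n) (<⇒≢ i<n)
                  (trans (r-sym i<K i₀<K (>⇒≢ i₀<i)) ri₀i) ri₀n

AgreeBelow : (ℕ → ℕ → Bool) → (ℕ → ℕ → Bool) → ℕ → Set
AgreeBelow r₁ r₂ n = ∀ {i j} → i < j → j < n → r₁ i j ≡ r₂ i j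

module _ {r₁ r₂ : ℕ → ℕ → Bool} where

  relatedBelow-agree : ∀ {n j m} → AgreeBelow r₁ r₂ n → j < n → m ≤ j →
                       relatedBelow r₁ j m ≡ relatedBelow r₂ j m
  relatedBelow-agree {m = zero}  _  _   _   = refl
  relatedBelow-agree {m = suc m} ag j<n m<j = cong₂ _∨_ (relatedBelow-agree ag j<n (<⇒≤ m<j)) (ag m<j j<n)

  blockCount-agree : ∀ {n m} → AgreeBelow r₁ r₂ n → m ≤ n → blockCount r₁ m ≡ blockCount r₂ m
  blockCount-agree {m = zero}  _  _   = refl
  blockCount-agree {m = suc m} ag m<n
    rewrite relatedBelow-agree ag m<n ≤-refl | blockCount-agree ag (<⇒≤ m<n) = refl

  AgreeBelow-suc : ∀ {n} → AgreeBelow r₁ r₂ n → (∀ {i} → i < n → r₁ i n ≡ r₂ i n) → AgreeBelow r₁ r₂ (suc n)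
  AgreeBelow-suc ag new i<j j<1+n with m<1+n⇒m<n∨m≡n j<1+n
  ... | inj₁ j<n  = ag i<j j<n
  ... | inj₂ refl = new i<j

module _ {K : ℕ} {r₁ r₂ : ℕ → ℕ → Bool}
         (sym₁ : SymmetricBelow K r₁) (trans₁ : TransitiveBelow K r₁)
         (sym₂ : SymmetricBelow K r₂) (trans₂ : TransitiveBelow K r₂) where

  private
    module _ {n : ℕ} (n<K : n < K) (ag : AgreeBelow r₁ r₂ n)
             (joins₁ : joinsEarlier r₁ n ≡ true) (joins₂ : joinsEarlier r₂ n ≡ true) where

      i₁ = firstRelated r₁ n n
      i₂ = firstRelated r₂ n n
      spec₁ = firstRelated-spec r₁ {n} {n} joins₁
      spec₂ = firstRelated-spec r₂ {n} {n} joins₂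

      firstRelated-agree : blockCount r₁ i₁ ≡ blockCount r₂ i₂ → i₁ ≡ i₂
      firstRelated-agree eq = count-injective (not ∘ joinsEarlier r₁)
        (cong not (firstRelated-opens trans₁ n<K joins₁))
        (cong not (trans (relatedBelow-agree ag (proj₁ spec₂) ≤-refl) (firstRelated-opens trans₂ n<K joins₂)))
        (trans eq (sym (blockCount-agree ag (<⇒≤ (proj₁ spec₂)))))

      agree-at-joiner : i₁ ≡ i₂ → ∀ {i} → i < n → r₁ i n ≡ r₂ i n
      agree-at-joiner i₁≡i₂ {i} i<n with <-cmp i i₁
      ... | tri< i<i₁ _ _ =
        trans (proj₂ (proj₂ spec₁) i<i₁) (sym (proj₂ (proj₂ spec₂) (subst (i <_) i₁≡i₂ i<i₁)))
      ... | tri≈ _ refl _ =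
        trans (proj₁ (proj₂ spec₁)) (sym (subst (λ z → r₂ z n ≡ true) (sym i₁≡i₂) (proj₁ (proj₂ spec₂))))
      ... | tri> _ _ i₁<i = begin
          r₁ i n  ≡⟨ related-through sym₁ trans₁ i₁<i i<n n<K (proj₁ (proj₂ spec₁)) ⟩
          r₁ i₁ i ≡⟨ ag i₁<i i<n ⟩
          r₂ i₁ i ≡⟨ cong (λ z → r₂ z i) i₁≡i₂ ⟩
          r₂ i₂ i ≡⟨ related-through sym₂ trans₂ (subst (_< i) i₁≡i₂ i₁<i) i<n n<K (proj₁ (proj₂ spec₂)) ⟨
          r₂ i n  ∎
        where open ≡-Reasoning

  blockLabel-agree : ∀ {n} → n < K → AgreeBelow r₁ r₂ n → blockLabel r₁ n ≡ blockLabel r₂ n →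
                     ∀ {i} → i < n → r₁ i n ≡ r₂ i n
  blockLabel-agree {n} n<K ag labels i<n with joinsEarlier r₁ n in joins₁ | joinsEarlier r₂ n in joins₂
  ... | false | false = trans (relatedBelow-false r₁ joins₁ i<n) (sym (relatedBelow-false r₂ joins₂ i<n))
  ... | true  | true  =
    agree-at-joiner n<K ag joins₁ joins₂ (firstRelated-agree n<K ag joins₁ joins₂ (suc-injective labels)) i<n

  blockCode-injective : ∀ {n} → n ≤ K → blockCode r₁ n ≡ blockCode r₂ n → AgreeBelow r₁ r₂ n
  blockCode-injective {zero}  _   _  _ ()
  blockCode-injective {suc n} n<K eq = AgreeBelow-suc ag (blockLabel-agree n<K ag (proj₁ (∷-injective eq)))
    where ag = blockCode-injective (<⇒≤ n<K) (proj₂ (∷-injective eq))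

does≡true⇒ : ∀ {A : Set} (a? : Dec A) → does a? ≡ true → A
does≡true⇒ (yes a) _ = a

toℕ-mod : ∀ {i k} .{{_ : NonZero k}} → i < k → toℕ (i mod k) ≡ i
toℕ-mod {i} {k} i<k = trans (toℕ-fromℕ< (m%n<n i k)) (m<n⇒m%n≡m i<k)

mod-toℕ : ∀ {k} .{{_ : NonZero k}} (x : Fin k) → toℕ x mod k ≡ x
mod-toℕ x = toℕ-injective (toℕ-mod (toℕ<n x))

mod-≢ : ∀ {i j k} .{{_ : NonZero k}} → i < k → j < k → i ≢ j → i mod k ≢ j mod k
mod-≢ i<k j<k i≢j eq = i≢j (trans (sym (toℕ-mod i<k)) (trans (cong toℕ eq) (toℕ-mod j<k)))

linkedBy : ∀ {k} .{{_ : NonZero k}} → System k → ℕ → ℕ → ℕ → Bool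
linkedBy {k} Γ q i j = does (q ∣? γ Γ (i mod k) (j mod k))

predecessors : ∀ {k} → Fin k → List (Fin k)
predecessors {k} j = filter (λ i → toℕ i <? toℕ j) (allFin k)

∈-predecessors⁻ : ∀ {k} {i j : Fin k} → i ∈ predecessors j → toℕ i < toℕ j
∈-predecessors⁻ {k} {j = j} i∈ = proj₂ (∈-filter⁻ (λ i → toℕ i <? toℕ j) {xs = allFin k} i∈)

∈-predecessors⁺ : ∀ {k} {i j : Fin k} → toℕ i < toℕ j → i ∈ predecessors j
∈-predecessors⁺ {i = i} {j} = ∈-filter⁺ (λ i → toℕ i <? toℕ j) (∈-allFin i)

module _ {k : ℕ} .{{_ : NonZero k}} (Γ : System k) (q : ℕ) where

  private r = linkedBy Γ q

  linkedBy-toℕ : ∀ i j → r (toℕ i) (toℕ j) ≡ does (q ∣? γ Γ i j)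
  linkedBy-toℕ i j rewrite mod-toℕ i | mod-toℕ j = refl

  linkedBy-symmetric : SymmetricBelow k r
  linkedBy-symmetric i<k j<k i≢j = cong (does ∘ (q ∣?_)) (symm Γ _ _ (mod-≢ i<k j<k i≢j))

  linkedBy-transitive : TransitiveBelow k r
  linkedBy-transitive i<k j<k l<k i≢j j≢l i≢l rij rjl = dec-true (q ∣? _)
    (∣-trans (gcd-greatest (does≡true⇒ (q ∣? _) rij) (does≡true⇒ (q ∣? _) rjl))
             (gcdCond Γ _ _ _ (mod-≢ i<k j<k i≢j) (mod-≢ j<k l<k j≢l) (mod-≢ i<k l<k i≢l)))

  module _ (q-prime : Prime q) where

    ∣gammaJ≡joinsEarlier : ∀ j → does (q ∣? gammaJ Γ j) ≡ joinsEarlier r (toℕ j)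
    ∣gammaJ≡joinsEarlier j = ⇔→≡ {z = true} (mk⇔ to from)
      where
      to : does (q ∣? gammaJ Γ j) ≡ true → joinsEarlier r (toℕ j) ≡ true
      to q∣γⱼ with prime∣lcmList⇒∣∈ q-prime _ (does≡true⇒ (q ∣? _) q∣γⱼ)
      ... | x , x∈ , q∣x with ∈-map⁻ (λ i → γ Γ i j) x∈
      ... | i , i∈ , refl = relatedBelow-intro r (∈-predecessors⁻ {j = j} i∈)
        (trans (linkedBy-toℕ i j) (dec-true (q ∣? _) q∣x))
      from : joinsEarlier r (toℕ j) ≡ true → does (q ∣? gammaJ Γ j) ≡ true
      from joins = dec-true (q ∣? _) (∣-trans q∣γᵢⱼ (∈⇒∣lcmList (∈-map⁺ (λ i → γ Γ i j) i∈)))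
        where
        i = firstRelated r (toℕ j) (toℕ j)
        spec = firstRelated-spec r {toℕ j} {toℕ j} joins
        i<k = <-trans (proj₁ spec) (toℕ<n j)
        i∈ : i mod k ∈ predecessors j
        i∈ = ∈-predecessors⁺ {j = j} (subst (_< toℕ j) (sym (toℕ-mod i<k)) (proj₁ spec))
        q∣γᵢⱼ : q ∣ γ Γ (i mod k) j
        q∣γᵢⱼ = subst (λ z → q ∣ γ Γ (i mod k) z) (mod-toℕ j) (does≡true⇒ (q ∣? _) (proj₁ (proj₂ spec)))

    prime²∤gammaJ : ∀ j → ¬ q * q ∣ gammaJ Γ j
    prime²∤gammaJ j = prime²∤lcmList q-prime
      (All.map⁺ (All.tabulate λ i∈ → sqfree Γ _ j (<⇒≢ (∈-predecessors⁻ i∈) ∘ cong toℕ) q q-prime))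

    ∥-gammaOf : (q , joinCount r k) ∥ gammaOf Γ
    ∥-gammaOf = subst (λ e → (q , e) ∥ gammaOf Γ) count-divisible
      (∥-product q-prime (All.map⁺ (All.tabulate {xs = allFin k} λ {j} _ → prime²∤gammaJ j)))
      where
      count-divisible : length (filter (q ∣?_) (map (gammaJ Γ) (allFin k))) ≡ joinCount r k
      count-divisible = trans (cong (length ∘ filter (q ∣?_)) (map-tabulate id (gammaJ Γ)))
        (length-filter-tabulate (q ∣?_) (gammaJ Γ) (joinsEarlier r) ∣gammaJ≡joinsEarlier)

module _ (k : ℕ) .{{_ : NonZero k}} (γ₀ : ℕ) .{{_ : NonZero γ₀}} where

  systemCode : System k → List (List ℕ)
  systemCode Γ = map (λ (q , _) → blockCode (linkedBy Γ q) k) (exactPrimePowers γ₀)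

  blockCodesFor : ℕ × ℕ → List (List ℕ)
  blockCodesFor (_ , e) = blockCodes k (k ∸ e)

  systemCodes : List (List (List ℕ))
  systemCodes = choices (map blockCodesFor (exactPrimePowers γ₀))

  length-systemCodes : length systemCodes ≡ stirlingProd k γ₀
  length-systemCodes = begin
      length systemCodes
    ≡⟨ length-choices (map blockCodesFor (exactPrimePowers γ₀)) ⟩
      product (map length (map blockCodesFor (exactPrimePowers γ₀)))
    ≡⟨ cong product (map-∘ {g = length} {f = blockCodesFor} (exactPrimePowers γ₀)) ⟨
      product (map (length ∘ blockCodesFor) (exactPrimePowers γ₀))
    ≡⟨ cong product (map-cong (λ (_ , e) → length-blockCodes k (k ∸ e)) (exactPrimePowers γ₀)) ⟩
      stirlingProd k γ₀ ∎
    where open ≡-Reasoning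

  joinCount≡exponent : ∀ {Γ : System k} {q e} → gammaOf Γ ≡ γ₀ → (q , e) ∈ exactPrimePowers γ₀ →
                       joinCount (linkedBy Γ q) k ≡ e
  joinCount≡exponent {Γ} {q} γΓ≡γ₀ qe∈ with ∈-filter⁻ (exactPrimePower? γ₀) {xs = pairsUpTo γ₀} qe∈
  ... | _ , q-prime , _ , qᵉ∥γ₀ =
    ∥-unique (subst ((q , joinCount (linkedBy Γ q) k) ∥_) γΓ≡γ₀ (∥-gammaOf Γ q q-prime)) qᵉ∥γ₀

  blockCount≡k∸e : ∀ {Γ : System k} {q e} → gammaOf Γ ≡ γ₀ → (q , e) ∈ exactPrimePowers γ₀ →
                   blockCount (linkedBy Γ q) k ≡ k ∸ e
  blockCount≡k∸e {Γ} {q} {e} γΓ≡γ₀ qe∈ = begin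
    blockCount r k                        ≡⟨ m+n∸n≡m (blockCount r k) (joinCount r k) ⟨
    blockCount r k + joinCount r k ∸ joinCount r k
      ≡⟨ cong₂ _∸_ (blockCount+joinCount r k) (joinCount≡exponent {Γ} γΓ≡γ₀ qe∈) ⟩
    k ∸ e                                 ∎
    where
    open ≡-Reasoning
    r = linkedBy Γ q

  systemCode-∈ : ∀ {Γ : System k} → gammaOf Γ ≡ γ₀ → systemCode Γ ∈ systemCodes
  systemCode-∈ {Γ} γΓ≡γ₀ = map-∈-choices _ _ _ λ {(q , e)} qe∈ →
    subst (λ b → blockCode (linkedBy Γ q) k ∈ blockCodes k b) (blockCount≡k∸e {Γ} γΓ≡γ₀ qe∈)
      (blockCode-∈ (linkedBy-transitive Γ q) {k} ≤-refl)

  γ∣γ₀ : ∀ {Γ : System k} → gammaOf Γ ≡ γ₀ → ∀ {i j} → toℕ i < toℕ j → γ Γ i j ∣ γ₀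
  γ∣γ₀ {Γ} γΓ≡γ₀ {i} {j} i<j = subst (γ Γ i j ∣_) γΓ≡γ₀ (∣-trans
    (∈⇒∣lcmList (∈-map⁺ (λ i → γ Γ i j) (∈-predecessors⁺ i<j)))
    (∈⇒∣product (∈-map⁺ (gammaJ Γ) (∈-allFin j))))

  prime∣γ₀⇒∈exactPrimePowers : ∀ {Γ : System k} {q} → gammaOf Γ ≡ γ₀ → Prime q → q ∣ γ₀ →
                               (q , joinCount (linkedBy Γ q) k) ∈ exactPrimePowers γ₀
  prime∣γ₀⇒∈exactPrimePowers {Γ} {q} γΓ≡γ₀ q-prime q∣γ₀
    with joinCount (linkedBy Γ q) k | subst ((q , joinCount (linkedBy Γ q) k) ∥_) γΓ≡γ₀ (∥-gammaOf Γ q q-prime)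
  ... | zero  | _ , q∤γ₀ = contradiction (subst (_∣ γ₀) (sym (*-identityʳ q)) q∣γ₀) q∤γ₀
  ... | suc _ | qᵉ∥γ₀    = ∥⇒∈exactPrimePowers q-prime (s≤s z≤n) qᵉ∥γ₀

  systemCode-prime∣γ : ∀ {Γ Δ : System k} → gammaOf Γ ≡ γ₀ → systemCode Γ ≡ systemCode Δ →
                       ∀ {i j} → toℕ i < toℕ j → ∀ {q} → Prime q → q ∣ γ Γ i j → q ∣ γ Δ i j
  systemCode-prime∣γ {Γ} {Δ} γΓ≡γ₀ codes≡ {i} {j} i<j {q} q-prime q∣γΓ =
    does≡true⇒ (q ∣? _) (trans (sym same-divisibility) (dec-true (q ∣? _) q∣γΓ))
    where
    q∈ = prime∣γ₀⇒∈exactPrimePowers {Γ} γΓ≡γ₀ q-prime (∣-trans q∣γΓ (γ∣γ₀ {Γ} γΓ≡γ₀ i<j))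
    agree : AgreeBelow (linkedBy Γ q) (linkedBy Δ q) k
    agree = blockCode-injective (linkedBy-symmetric Γ q) (linkedBy-transitive Γ q)
      (linkedBy-symmetric Δ q) (linkedBy-transitive Δ q) ≤-refl (map-≡-at codes≡ q∈)
    same-divisibility : does (q ∣? γ Γ i j) ≡ does (q ∣? γ Δ i j)
    same-divisibility = trans (sym (linkedBy-toℕ Γ q i j)) (trans (agree i<j (toℕ<n j)) (linkedBy-toℕ Δ q i j))

  systemCode-prime∣γ-≢ : ∀ {Γ Δ : System k} → gammaOf Γ ≡ γ₀ → systemCode Γ ≡ systemCode Δ →
                         ∀ {i j} → i ≢ j → ∀ {q} → Prime q → q ∣ γ Γ i j → q ∣ γ Δ i j
  systemCode-prime∣γ-≢ {Γ} {Δ} γΓ≡γ₀ codes≡ {i} {j} i≢j {q} q-prime q∣γΓ with <-cmp (toℕ i) (toℕ j)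
  ... | tri< i<j _ _ = systemCode-prime∣γ {Γ} {Δ} γΓ≡γ₀ codes≡ i<j q-prime q∣γΓ
  ... | tri≈ _ i≡j _ = contradiction (toℕ-injective i≡j) i≢j
  ... | tri> _ _ j<i = subst (q ∣_) (symm Δ j i (≢-sym i≢j))
    (systemCode-prime∣γ {Γ} {Δ} γΓ≡γ₀ codes≡ j<i q-prime (subst (q ∣_) (symm Γ i j i≢j) q∣γΓ))

  systemCode-injective : ∀ {Γ Δ : System k} → gammaOf Γ ≡ γ₀ → gammaOf Δ ≡ γ₀ →
                         Different Γ Δ → systemCode Γ ≢ systemCode Δ
  systemCode-injective {Γ} {Δ} γΓ≡γ₀ γΔ≡γ₀ (i , j , i≢j , γΓ≢γΔ) codes≡ = γΓ≢γΔ
    (squarefree-≡ {{>-nonZero (positive Γ i j i≢j)}} {{>-nonZero (positive Δ i j i≢j)}}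
      (sqfree Γ i j i≢j) (sqfree Δ i j i≢j)
      (systemCode-prime∣γ-≢ {Γ} {Δ} γΓ≡γ₀ codes≡ i≢j) (systemCode-prime∣γ-≢ {Δ} {Γ} γΔ≡γ₀ (sym codes≡) i≢j))

  length≤stirlingProd : (Γs : List (System k)) → AllPairs Different Γs →
                        All (λ Γ → gammaOf Γ ≡ γ₀) Γs → length Γs ≤ stirlingProd k γ₀
  length≤stirlingProd Γs different γΓs≡γ₀ = begin
      length Γs
    ≡⟨ length-map systemCode Γs ⟨
      length (map systemCode Γs)
    ≤⟨ distinct-⊆⇒length-≤
         (map-AllPairs-≢ systemCode (λ {Γ} {Δ} → systemCode-injective {Γ} {Δ}) γΓs≡γ₀ different)
         (All.map⁺ (All.map (λ {Γ} → systemCode-∈ {Γ}) γΓs≡γ₀)) ⟩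
      length systemCodes
    ≡⟨ length-systemCodes ⟩
      stirlingProd k γ₀ ∎
    where open ≤-Reasoning

lemma3p2 : (k γ₀ : ℕ) → 2 ≤ k → 0 < γ₀ →
    ((Γs : List (System k)) → AllPairs Different Γs →
       All (λ Γ → gammaOf Γ ≡ γ₀) Γs → length Γs ≤ stirlingProd k γ₀)
    × stirlingProd k γ₀ ≤ (k C 2) ^ numPrimePowers γ₀
lemma3p2 k@(suc _) γ₀ 2≤k γ₀>0 =
  length≤stirlingProd k γ₀ {{>-nonZero γ₀>0}} , stirlingProd≤[kC2]^numPrimePowers k γ₀ 2≤k
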